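{- Let $G$ and $G'$ be sun-like graphs whose cycles have the same length $\ell$ and such that, for every $i\ge1$, $G$ and $G'$ have the same number $k_i$ of $i$-hubs. Let $s\ge1$. For a sun-like graph $F$, let $\mathcal D^{*}_s(F)$ be the set of decorated $s$-routes in $F$ which interact with at most one hub (possibly many times). Then $\sum_{R\in\mathcal D^{*}_s(G)}w(R)=\sum_{R\in\mathcal D^{*}_s(G')}w(R)$; that is, this sum depends only on $\ell$ and $(k_i)_{i\ge1}$.
   Context: All graphs are finite and simple. A graph is sun-like if it is connected and deleting all degree-1 vertices yields a cycle $C$; the remaining vertices are leaves attached to vertices of $C$. A vertex of $C$ with exactly $i$ leaves attached is an $i$-hub; a hub is an $i$-hub with $i\ge1$. An $s$-route is a sequence of vertices $(v_1,\dots,v_s)$ such that for each $j$ (indices mod $s$) either $v_jv_{j+1}$ is an edge or $v_j=v_{j+1}$ (a "waiting step"). A decorated $s$-route is an $s$-route together with a label "look" or "wait" assigned to each index $j$ with $v_j=v_{j+1}$ and $v_j$ a hub. The decorated route interacts with a hub $v$ at step $j$ if either $v_j=v_{j+1}=v$ and $j$ is labelled "look", or $v_j=v$ and $v_{j+1}$ is one of the leaves attached to $v$. If in a decorated route there are $r_2$ indices $j$ with $v_j=v_{j+1}$ a vertex of $C$ that is not labelled "look" (i.e. waiting at cycle vertices), and for each $i$ there are $t_i$ steps labelled "look" at an $i$-hub, its weight is $w(R)=2^{r_2}\prod_{i\ge1}i^{t_i}$ (waiting steps at leaves contribute no factor). -}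

module Defs where

open import Data.Nat using (ℕ; zero; suc; _+_; _*_; _^_; _≤_; NonZero)
open import Data.Nat.DivMod using (_mod_)
open import Data.Bool using (Bool; true; false; _∧_; _∨_; not; if_then_else_)
open import Data.Fin using (Fin; toℕ)
import Data.Fin as F
open import Data.Sum using (_⊎_; inj₁; inj₂)
open import Data.Product using (Σ; _×_; _,_; proj₁; proj₂)
open import Data.List using (List; []; _∷_; map; concatMap; _++_; allFin; length; filter; cartesianProduct)
open import Data.Maybe using (Maybe; just; nothing)
open import Relation.Nullary.Decidable using (⌊_⌋)
import Data.Nat as N
open import Data.Nat.ListAction using (sum; product)
import Data.Vec.Functional as VF

-- A sun-like graph is determined by the length ℓ ≥ 3 of its cycle C
-- (cycle vertices 0,…,ℓ-1, with c adjacent to c+1 mod ℓ) and, for each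
-- cycle vertex c, the number  leaves c  of leaves attached to c.

record SunLike : Set where
  field
    ℓ      : ℕ
    3≤ℓ    : 3 ≤ ℓ
    leaves : Fin ℓ → ℕ

open SunLike public

Vertex : SunLike → Set
Vertex G = Fin (ℓ G) ⊎ Σ (Fin (ℓ G)) (λ c → Fin (leaves G c))

allVertices : (G : SunLike) → List (Vertex G)
allVertices G =
  map inj₁ (allFin (ℓ G)) ++
  concatMap (λ c → map (λ i → inj₂ (c , i)) (allFin (leaves G c))) (allFin (ℓ G))

next : ∀ {s} → Fin s → Fin s
next {suc n} j = suc (toℕ j) mod (suc n)

finEq : ∀ {n m} → Fin n → Fin m → Bool
finEq a b = ⌊ toℕ a N.≟ toℕ b ⌋

eqV : (G : SunLike) → Vertex G → Vertex G → Bool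
eqV G (inj₁ a) (inj₁ b) = finEq a b
eqV G (inj₁ a) (inj₂ b) = false
eqV G (inj₂ a) (inj₁ b) = false
eqV G (inj₂ (a , i)) (inj₂ (b , j)) = finEq a b ∧ finEq i j

cycAdj : ∀ {ℓ} → Fin ℓ → Fin ℓ → Bool
cycAdj a b = finEq b (next a) ∨ finEq a (next b)

adj : (G : SunLike) → Vertex G → Vertex G → Bool
adj G (inj₁ a) (inj₁ b) = cycAdj a b
adj G (inj₁ a) (inj₂ (b , _)) = finEq a b
adj G (inj₂ (a , _)) (inj₁ b) = finEq a b
adj G (inj₂ _) (inj₂ _) = false

isHub : (G : SunLike) → Fin (ℓ G) → Bool
isHub G c = ⌊ 1 N.≤? leaves G c ⌋

hubCount : (G : SunLike) → ℕ → ℕ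
hubCount G i = length (filter (λ c → leaves G c N.≟ i) (allFin (ℓ G)))

-- Routes. Indices of an s-route are Fin s, taken mod s (successor: next).

allFuns : ∀ {A : Set} (s : ℕ) → List A → List (Fin s → A)
allFuns zero xs = (λ ()) ∷ []
allFuns (suc s) xs = concatMap (λ x → map (λ f → x VF.∷ f) (allFuns s xs)) xs

-- Labels: true = "look", false = "wait".
-- A decorated s-route is encoded as a pair (v , lab) with v : Fin s → Vertex G
-- and lab : Fin s → Bool, where lab is required to be false ("no label")
-- at every index j that is not a waiting step at a hub; at waiting steps at a
-- hub, lab j is the label (look/wait).  This encoding is a bijection with
-- decorated s-routes.
DRoute : SunLike → ℕ → Set
DRoute G s = (Fin s → Vertex G) × (Fin s → Bool)

module _ (G : SunLike) {s : ℕ} where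

  all-idx : (Fin s → Bool) → Bool
  all-idx p = Data.List.foldr _∧_ true (map p (allFin s))

  waitCyc : (Fin s → Vertex G) → Fin s → Bool
  waitCyc v j with v j | v (next j)
  ... | inj₁ a | inj₁ b = finEq a b
  ... | _      | _      = false

  waitHub : (Fin s → Vertex G) → Fin s → Bool
  waitHub v j with v j | v (next j)
  ... | inj₁ a | inj₁ b = finEq a b ∧ isHub G a
  ... | _      | _      = false

  isRoute : (Fin s → Vertex G) → Bool
  isRoute v = all-idx (λ j → eqV G (v j) (v (next j)) ∨ adj G (v j) (v (next j)))

  isDecoration : (Fin s → Vertex G) → (Fin s → Bool) → Bool
  isDecoration v lab = all-idx (λ j → not (lab j) ∨ waitHub v j)

  interactsAt : DRoute G s → Fin s → Maybe (Fin (ℓ G))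
  interactsAt (v , lab) j with v j | v (next j)
  ... | inj₁ a | inj₁ b = if finEq a b ∧ lab j then just a else nothing
  ... | inj₁ a | inj₂ (b , _) = if finEq a b then just a else nothing
  ... | inj₂ _ | _ = nothing

  sameOrNone : Maybe (Fin (ℓ G)) → Maybe (Fin (ℓ G)) → Bool
  sameOrNone (just a) (just b) = finEq a b
  sameOrNone _ _ = true

  atMostOneHub : DRoute G s → Bool
  atMostOneHub R = all-idx (λ j → all-idx (λ j' → sameOrNone (interactsAt R j) (interactsAt R j')))

  inDstar : DRoute G s → Bool
  inDstar (v , lab) = isRoute v ∧ isDecoration v lab ∧ atMostOneHub (v , lab)

  count-idx : (Fin s → Bool) → ℕ
  count-idx p = length (filter (λ j → Data.Bool._≟_ (p j) true) (allFin s))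

  r₂ : DRoute G s → ℕ
  r₂ (v , lab) = count-idx (λ j → waitCyc v j ∧ not (lab j))

  -- ∏_i i^{t_i} = product over look-steps j of the number of leaves at v j
  lookFactor : DRoute G s → Fin s → ℕ
  lookFactor (v , lab) j with lab j | v j
  ... | true | inj₁ c = leaves G c
  ... | _    | _      = 1

  weight : DRoute G s → ℕ
  weight R = 2 ^ r₂ R * product (map (lookFactor R) (allFin s))

allDRoutes : (G : SunLike) (s : ℕ) → List (DRoute G s)
allDRoutes G s = cartesianProduct (allFuns s (allVertices G)) (allFuns s (true ∷ false ∷ []))

DstarSum : (G : SunLike) (s : ℕ) → ℕ
DstarSum G s = sum (map (weight G) (filter (λ R → Data.Bool._≟_ (inDstar G R) true) (allDRoutes G s)))

-- For a scope m, either no hub or a single hub c, let T(m) be the weighted number of decorated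
-- s-routes that visit only cycle vertices and leaves of m and interact with no hub other than m.
-- A route can only step onto a leaf from its hub, and that step interacts with the hub, unless the
-- route sits on the leaf throughout.  So the interactions and visited leaves of a route in D*_s
-- belong to at most one hub, and inclusion-exclusion over the ℓ cycle vertices gives
--   Σ_{R ∈ D*_s} w(R) + (ℓ - 1) T(none) = Σ_c T(c).
-- T(none) only involves the cycle, so it depends only on ℓ.  Rotating c to a fixed position and
-- discarding the other hubs shows that T(c) = τ(i) depends only on ℓ and the number i of leaves
-- at c.  Hence Σ_c T(c) = Σ_i k_i τ(i) with k_0 = ℓ - Σ_{i ≥ 1} k_i, and the claim follows by
-- cancelling (ℓ - 1) T(none).

module Submission where

open import Defs
open import Data.Bool using (Bool; true; false; if_then_else_; _∧_; _∨_; not) renaming (_≟_ to _≟ᵇ_)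
open import Data.Bool.ListAction using (and; all)
open import Data.Bool.Properties using (∧-zeroʳ; ∧-comm; ∧-assoc; ∧-conicalˡ)
open import Data.Fin using (Fin; toℕ; fromℕ; fromℕ<; inject₁; punchIn) renaming (zero to fzero; suc to fsuc)
import Data.Fin as Fin
open import Data.Fin.Induction using (<-weakInduction; >-weakInduction)
open import Data.Fin.Properties using (any?; toℕ-injective; toℕ-fromℕ<; toℕ-inject₁; toℕ-fromℕ; toℕ<n; punchInᵢ≢i)
open import Data.List using (List; []; _∷_; map; concatMap; _++_; allFin; length; filter; cartesianProduct; tabulate)
open import Data.List.Membership.Propositional using (_∈_)
open import Data.List.Membership.Propositional.Properties using (∈-allFin; ∈-map⁺; ∈-map⁻; ∈-++⁺ˡ; ∈-++⁻)
open import Data.List.Properties using (map-cong; map-++; map-∘)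
open import Data.List.Relation.Unary.Any using (here; there)
open import Data.Maybe using (Maybe; just; nothing)
import Data.Maybe.Properties as Maybe
open import Data.Nat using (ℕ; zero; suc; _+_; _*_; _^_; _≤_; _<_; z≤n; s≤s)
open import Data.Nat.DivMod using (_%_; m<n⇒m%n≡m; n%n≡0)
open import Data.Nat.ListAction using (sum; product)
open import Data.Nat.ListAction.Properties using (sum-++)
open import Data.Nat.Properties
open import Data.Product using (_×_; _,_; ∃)
open import Data.Sum using (_⊎_; inj₁; inj₂)
import Data.Vec.Functional as Vec
open import Function using (_∘_; id; _⇔_; mk⇔)
open import Relation.Binary.PropositionalEquality
open import Relation.Nullary using (yes; no; does; contradiction)
open import Relation.Nullary.Decidable using (isYes≗does; does-⇔; dec-true; dec-false)
open import Relation.Unary using (Pred; Decidable)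

open import Algebra.Properties.CommutativeSemigroup +-commutativeSemigroup using () renaming (interchange to +-interchange)
open import Algebra.Properties.CommutativeSemigroup *-commutativeSemigroup using () renaming (interchange to *-interchange)
open import Algebra.Properties.Semiring.Sum +-*-semiring
  using (sum-syntax; sum-cong-≗; ∑-distrib-+; ∑-comm; sum-init-last; sum-replicate-zero; sum-remove; *-distribʳ-sum)
  renaming (sum to ∑)

private variable
  n : ℕ
  A B : Set

∑∈ : List A → (A → ℕ) → ℕ
∑∈ xs f = sum (map f xs)

infixl 10 ∑∈
syntax ∑∈ xs (λ x → e) = ∑[ x ∈ xs ] e

∑∈-cong : ∀ (xs : List A) {f g : A → ℕ} → (∀ x → f x ≡ g x) → ∑[ x ∈ xs ] f x ≡ ∑[ x ∈ xs ] g x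
∑∈-cong xs f≗g = cong sum (map-cong f≗g xs)

∑∈-++ : ∀ (xs ys : List A) (f : A → ℕ) → ∑[ x ∈ xs ++ ys ] f x ≡ ∑[ x ∈ xs ] f x + ∑[ y ∈ ys ] f y
∑∈-++ xs ys f = trans (cong sum (map-++ f xs ys)) (sum-++ (map f xs) (map f ys))

∑∈-map : ∀ (xs : List A) (e : A → B) (f : B → ℕ) → ∑[ y ∈ map e xs ] f y ≡ ∑[ x ∈ xs ] f (e x)
∑∈-map xs e f = cong sum (sym (map-∘ xs))

∑∈-concatMap : ∀ (xs : List A) (ys : A → List B) (f : B → ℕ) →
               ∑[ y ∈ concatMap ys xs ] f y ≡ ∑[ x ∈ xs ] ∑[ y ∈ ys x ] f y
∑∈-concatMap []       ys f = refl
∑∈-concatMap (x ∷ xs) ys f = trans (∑∈-++ (ys x) (concatMap ys xs) f) (cong (_ +_) (∑∈-concatMap xs ys f))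

∑∈-cartesianProduct : ∀ (xs : List A) (ys : List B) (f : A × B → ℕ) →
                      ∑[ p ∈ cartesianProduct xs ys ] f p ≡ ∑[ x ∈ xs ] ∑[ y ∈ ys ] f (x , y)
∑∈-cartesianProduct []       ys f = refl
∑∈-cartesianProduct (x ∷ xs) ys f =
  trans (∑∈-++ (map (x ,_) ys) _ f) (cong₂ _+_ (∑∈-map ys (x ,_) f) (∑∈-cartesianProduct xs ys f))

∑∈-zero : ∀ (xs : List A) {f : A → ℕ} → (∀ x → f x ≡ 0) → ∑[ x ∈ xs ] f x ≡ 0
∑∈-zero []       f≡0 = refl
∑∈-zero (x ∷ xs) f≡0 = cong₂ _+_ (f≡0 x) (∑∈-zero xs f≡0)

∑∈-distrib-+ : ∀ (xs : List A) (f g : A → ℕ) → ∑[ x ∈ xs ] (f x + g x) ≡ ∑[ x ∈ xs ] f x + ∑[ x ∈ xs ] g x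
∑∈-distrib-+ []       f g = refl
∑∈-distrib-+ (x ∷ xs) f g = trans (cong (f x + g x +_) (∑∈-distrib-+ xs f g)) (+-interchange (f x) (g x) _ _)

*-distribˡ-∑∈ : ∀ k (xs : List A) (f : A → ℕ) → k * ∑[ x ∈ xs ] f x ≡ ∑[ x ∈ xs ] (k * f x)
*-distribˡ-∑∈ k []       f = *-zeroʳ k
*-distribˡ-∑∈ k (x ∷ xs) f = trans (*-distribˡ-+ k (f x) _) (cong (k * f x +_) (*-distribˡ-∑∈ k xs f))

∑∈-filter : ∀ (xs : List A) (p : A → Bool) (f : A → ℕ) →
            ∑[ x ∈ filter (λ x → p x ≟ᵇ true) xs ] f x ≡ ∑[ x ∈ xs ] (if p x then f x else 0)
∑∈-filter []       p f = refl
∑∈-filter (x ∷ xs) p f with p x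
... | true  = cong (f x +_) (∑∈-filter xs p f)
... | false = ∑∈-filter xs p f

∑∈-tabulate : ∀ n (g : Fin n → A) (f : A → ℕ) → ∑[ x ∈ tabulate g ] f x ≡ ∑[ i < n ] f (g i)
∑∈-tabulate zero    g f = refl
∑∈-tabulate (suc n) g f = cong (f (g fzero) +_) (∑∈-tabulate n (g ∘ fsuc) f)

∑∈-allFin : ∀ n (f : Fin n → ℕ) → ∑[ i ∈ allFin n ] f i ≡ ∑[ i < n ] f i
∑∈-allFin n = ∑∈-tabulate n (λ i → i)

∑∈-∑-comm : ∀ (xs : List A) n (f : A → Fin n → ℕ) → ∑[ x ∈ xs ] ∑[ i < n ] f x i ≡ ∑[ i < n ] ∑[ x ∈ xs ] f x i
∑∈-∑-comm []       n f = sym (sum-replicate-zero n)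
∑∈-∑-comm (x ∷ xs) n f = trans (cong (_ +_) (∑∈-∑-comm xs n f)) (sym (∑-distrib-+ (f x) _))

∑-single : ∀ (f : Fin (suc n) → ℕ) c → (∀ d → d ≢ c → f d ≡ 0) → ∑[ i < suc n ] f i ≡ f c
∑-single {n} f c others≡0 = begin
  ∑[ i < suc n ] f i                ≡⟨ sum-remove {i = c} f ⟩
  f c + ∑[ j < n ] f (punchIn c j)  ≡⟨ cong (f c +_) (sum-cong-≗ (λ j → others≡0 _ (punchInᵢ≢i c j))) ⟩
  f c + ∑[ j < n ] 0                ≡⟨ cong (f c +_) (sum-replicate-zero n) ⟩
  f c + 0                           ≡⟨ +-identityʳ (f c) ⟩
  f c                               ∎
  where open ≡-Reasoning

term≤∑ : ∀ (f : Fin n → ℕ) c → f c ≤ ∑[ i < n ] f i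
term≤∑ f fzero    = m≤m+n (f fzero) _
term≤∑ f (fsuc c) = ≤-trans (term≤∑ (f ∘ fsuc) c) (m≤n+m _ (f fzero))

∑-const : ∀ n k → ∑[ i < n ] k ≡ n * k
∑-const zero    k = refl
∑-const (suc n) k = cong (k +_) (∑-const n k)

length-filter≡∑ : ∀ {ℓ} {P : Pred A ℓ} (P? : Decidable P) xs →
                  length (filter P? xs) ≡ ∑[ x ∈ xs ] (if does (P? x) then 1 else 0)
length-filter≡∑ P? []       = refl
length-filter≡∑ P? (x ∷ xs) with does (P? x)
... | true  = cong suc (length-filter≡∑ P? xs)
... | false = length-filter≡∑ P? xs

∑-indicator : ∀ M {a} (g : ℕ → ℕ) → a ≤ M → ∑[ i < suc M ] ((if does (a ≟ toℕ i) then 1 else 0) * g (toℕ i)) ≡ g a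
∑-indicator M {a} g a≤M = trans (∑-single _ i₀ others) at-i₀
  where
  i₀ : Fin (suc M)
  i₀ = fromℕ< (s≤s a≤M)
  others : ∀ i → i ≢ i₀ → (if does (a ≟ toℕ i) then 1 else 0) * g (toℕ i) ≡ 0
  others i i≢i₀ rewrite dec-false (a ≟ toℕ i) (λ a≡i → i≢i₀ (toℕ-injective (trans (sym a≡i) (sym (toℕ-fromℕ< (s≤s a≤M))))))
    = refl
  at-i₀ : (if does (a ≟ toℕ i₀) then 1 else 0) * g (toℕ i₀) ≡ g a
  at-i₀ rewrite toℕ-fromℕ< (s≤s a≤M) | dec-true (a ≟ a) refl = +-identityʳ (g a)

module _ {m} (L : Fin m → ℕ) where

  countValue : ℕ → ℕ
  countValue i = length (filter (λ c → L c ≟ i) (allFin m))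

  ∑-byValue : ∀ M → (∀ c → L c ≤ M) → ∀ (g : ℕ → ℕ) →
              ∑[ c < m ] g (L c) ≡ ∑[ i < suc M ] (countValue (toℕ i) * g (toℕ i))
  ∑-byValue M L≤M g = begin
    ∑[ c < m ] g (L c)
      ≡⟨ sum-cong-≗ (λ c → ∑-indicator M g (L≤M c)) ⟨
    ∑[ c < m ] ∑[ i < suc M ] (δ c i * g (toℕ i))
      ≡⟨ ∑-comm (λ c i → δ c i * g (toℕ i)) ⟩
    ∑[ i < suc M ] ∑[ c < m ] (δ c i * g (toℕ i))
      ≡⟨ sum-cong-≗ (λ i → *-distribʳ-sum (g (toℕ i)) (λ c → δ c i)) ⟨
    ∑[ i < suc M ] (∑[ c < m ] δ c i * g (toℕ i))
      ≡⟨ sum-cong-≗ {suc M} (λ i → cong (_* g (toℕ i))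
           (trans (length-filter≡∑ (λ c → L c ≟ toℕ i) (allFin m)) (∑∈-allFin m _))) ⟨
    ∑[ i < suc M ] (countValue (toℕ i) * g (toℕ i)) ∎
    where
    open ≡-Reasoning
    δ : Fin m → Fin (suc M) → ℕ
    δ c i = if does (L c ≟ toℕ i) then 1 else 0

∑-sameValueCounts : ∀ {m} (L L′ : Fin m → ℕ) → (∀ i → 1 ≤ i → countValue L i ≡ countValue L′ i) →
                    ∀ (g : ℕ → ℕ) → ∑[ c < m ] g (L c) ≡ ∑[ c < m ] g (L′ c)
∑-sameValueCounts {m} L L′ same g = begin
  ∑[ c < m ] g (L c)                                  ≡⟨ ∑-byValue L M L≤M g ⟩
  ∑[ i < suc M ] (countValue L (toℕ i) * g (toℕ i))   ≡⟨ sum-cong-≗ {suc M} (λ i → cong (_* g (toℕ i)) (sameCount (toℕ i))) ⟩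
  ∑[ i < suc M ] (countValue L′ (toℕ i) * g (toℕ i))  ≡⟨ ∑-byValue L′ M L′≤M g ⟨
  ∑[ c < m ] g (L′ c)                                 ∎
  where
  open ≡-Reasoning
  M = ∑[ c < m ] L c + ∑[ c < m ] L′ c
  L≤M : ∀ c → L c ≤ M
  L≤M c = ≤-trans (term≤∑ L c) (m≤m+n _ _)
  L′≤M : ∀ c → L′ c ≤ M
  L′≤M c = ≤-trans (term≤∑ L′ c) (m≤n+m _ _)
  -- The count of the value 0 is not assumed; it is recovered from the total m (take g = 1).
  sameCount : ∀ i → countValue L i ≡ countValue L′ i
  sameCount (suc i) = same (suc i) (s≤s z≤n)
  sameCount zero    = *-cancelʳ-≡ _ _ 1 (+-cancelʳ-≡ _ _ _ (begin
    countValue L 0 * 1 + ∑[ i < M ] (countValue L (suc (toℕ i)) * 1)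
      ≡⟨ trans (sym (∑-byValue L M L≤M (λ _ → 1))) (∑-byValue L′ M L′≤M (λ _ → 1)) ⟩
    countValue L′ 0 * 1 + ∑[ i < M ] (countValue L′ (suc (toℕ i)) * 1)
      ≡⟨ cong (countValue L′ 0 * 1 +_) (sum-cong-≗ {M} (λ i → cong (_* 1) (same (suc (toℕ i)) (s≤s z≤n)))) ⟨
    countValue L′ 0 * 1 + ∑[ i < M ] (countValue L (suc (toℕ i)) * 1) ∎))

all-elim : ∀ (p : A → Bool) {xs x} → all p xs ≡ true → x ∈ xs → p x ≡ true
all-elim p {y ∷ xs} eq (here refl) with p y
... | true = refl
all-elim p {y ∷ xs} eq (there x∈xs) with p y
... | true = all-elim p eq x∈xs

all-intro : ∀ (p : A → Bool) xs → (∀ x → x ∈ xs → p x ≡ true) → all p xs ≡ true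
all-intro p []       h = refl
all-intro p (x ∷ xs) h rewrite h x (here refl) = all-intro p xs (λ y → h y ∘ there)

all-false : ∀ (p : A → Bool) {xs x} → x ∈ xs → p x ≡ false → all p xs ≡ false
all-false p (here refl) px≡false rewrite px≡false = refl
all-false p {y ∷ xs} (there x∈xs) px≡false with p y
... | true  = all-false p x∈xs px≡false
... | false = refl

bool-ext : ∀ {a b : Bool} → (a ≡ true → b ≡ true) → (b ≡ true → a ≡ true) → a ≡ b
bool-ext {true}  {true}  _ _ = refl
bool-ext {true}  {false} f _ = sym (f refl)
bool-ext {false} {true}  _ g = g refl
bool-ext {false} {false} _ _ = refl

all-∧ : ∀ (p q : A → Bool) xs → all (λ x → p x ∧ q x) xs ≡ all p xs ∧ all q xs
all-∧ p q []       = refl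
all-∧ p q (x ∷ xs) with p x | q x
... | true  | true  = all-∧ p q xs
... | true  | false = sym (∧-zeroʳ (all p xs))
... | false | _     = refl

all-++ : ∀ (p : A → Bool) xs ys → all p (xs ++ ys) ≡ all p xs ∧ all p ys
all-++ p []       ys = refl
all-++ p (x ∷ xs) ys with p x
... | true  = all-++ p xs ys
... | false = refl

all-map : ∀ (p : B → Bool) (f : A → B) xs → all p (map f xs) ≡ all (p ∘ f) xs
all-map p f xs = cong and (sym (map-∘ xs))

all-cong : ∀ {p q : A → Bool} xs → (∀ x → p x ≡ q x) → all p xs ≡ all q xs
all-cong xs p≗q = cong and (map-cong p≗q xs)

product-zero : ∀ (xs : List A) {f : A → ℕ} {x} → x ∈ xs → f x ≡ 0 → product (map f xs) ≡ 0
product-zero (y ∷ xs) {f} (here refl)  fx≡0 = cong (_* product (map f xs)) fx≡0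
product-zero (y ∷ xs) {f} (there x∈xs) fx≡0 = trans (cong (f y *_) (product-zero xs x∈xs fx≡0)) (*-zeroʳ (f y))

product-if : ∀ (b : A → Bool) (w : A → ℕ) xs →
             product (map (λ x → if b x then w x else 0) xs) ≡ (if all b xs then product (map w xs) else 0)
product-if b w []       = refl
product-if b w (x ∷ xs) with b x
... | false = refl
... | true rewrite product-if b w xs with all b xs
...   | true  = refl
...   | false = *-zeroʳ (w x)

product-* : ∀ (f g : A → ℕ) xs → product (map (λ x → f x * g x) xs) ≡ product (map f xs) * product (map g xs)
product-* f g []       = refl
product-* f g (x ∷ xs) = trans (cong (f x * g x *_) (product-* f g xs)) (*-interchange (f x) (g x) _ _)

product-2^ : ∀ (q : A → Bool) xs →
             product (map (λ x → if q x then 2 else 1) xs) ≡ 2 ^ length (filter (λ x → q x ≟ᵇ true) xs)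
product-2^ q []       = refl
product-2^ q (x ∷ xs) with q x
... | true  = cong (2 *_) (product-2^ q xs)
... | false = trans (+-identityʳ _) (product-2^ q xs)

finEq-⇔ : ∀ {m k l} {a : Fin n} {b : Fin m} {c : Fin k} {d : Fin l} →
          (toℕ a ≡ toℕ b ⇔ toℕ c ≡ toℕ d) → finEq a b ≡ finEq c d
finEq-⇔ {a = a} {b} {c} {d} equiv =
  trans (isYes≗does (toℕ a ≟ toℕ b))
        (trans (does-⇔ equiv (toℕ a ≟ toℕ b) (toℕ c ≟ toℕ d)) (sym (isYes≗does (toℕ c ≟ toℕ d))))

finEq-refl : ∀ (a : Fin n) → finEq a a ≡ true
finEq-refl a with toℕ a ≟ toℕ a
... | yes _   = refl
... | no a≢a = contradiction refl a≢a

finEq⇒≡ : ∀ {a b : Fin n} → finEq a b ≡ true → a ≡ b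
finEq⇒≡ {a = a} {b} eq with toℕ a ≟ toℕ b
finEq⇒≡ refl | yes p = toℕ-injective p

≢⇒finEq-false : ∀ {a b : Fin n} → a ≢ b → finEq a b ≡ false
≢⇒finEq-false {a = a} {b} a≢b with toℕ a ≟ toℕ b
... | yes p = contradiction (toℕ-injective p) a≢b
... | no _  = refl

finEq-sym : ∀ (a b : Fin n) → finEq a b ≡ finEq b a
finEq-sym a b = finEq-⇔ (mk⇔ sym sym)

finEq-injective : ∀ {m} (σ : Fin n → Fin m) → (∀ {a b} → σ a ≡ σ b → a ≡ b) →
                  ∀ a b → finEq (σ a) (σ b) ≡ finEq a b
finEq-injective σ σ-injective a b =
  finEq-⇔ (mk⇔ (cong toℕ ∘ σ-injective ∘ toℕ-injective) (cong toℕ ∘ cong σ ∘ toℕ-injective))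

next-inject₁ : ∀ (i : Fin n) → next (inject₁ i) ≡ fsuc i
next-inject₁ {n} i = toℕ-injective (begin
  toℕ (next (inject₁ i))     ≡⟨ toℕ-fromℕ< _ ⟩
  suc (toℕ (inject₁ i)) % suc n ≡⟨ m<n⇒m%n≡m (s≤s (subst (_< n) (sym (toℕ-inject₁ i)) (toℕ<n i))) ⟩
  suc (toℕ (inject₁ i))      ≡⟨ cong suc (toℕ-inject₁ i) ⟩
  suc (toℕ i)                ∎)
  where open ≡-Reasoning

next-fromℕ : ∀ n → next (fromℕ n) ≡ fzero
next-fromℕ n = toℕ-injective (trans (toℕ-fromℕ< _) (trans (cong (λ k → suc k % suc n) (toℕ-fromℕ n)) (n%n≡0 (suc n))))

prev : Fin (suc n) → Fin (suc n)
prev {n} fzero    = fromℕ n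
prev     (fsuc i) = inject₁ i

prev-next : ∀ (c : Fin (suc n)) → prev (next c) ≡ c
prev-next {n} = >-weakInduction (λ c → prev (next c) ≡ c)
  (cong prev (next-fromℕ n))
  (λ i _ → cong prev (next-inject₁ i))

next-injective : ∀ {a b : Fin (suc n)} → next a ≡ next b → a ≡ b
next-injective {a = a} {b} eq = trans (sym (prev-next a)) (trans (cong prev eq) (prev-next b))

∑-next : ∀ (f : Fin (suc n) → ℕ) → ∑[ i < suc n ] f (next i) ≡ ∑[ i < suc n ] f i
∑-next {n} f = begin
  ∑[ i < suc n ] f (next i)                           ≡⟨ sum-init-last (f ∘ next) ⟩
  ∑[ i < n ] f (next (inject₁ i)) + f (next (fromℕ n)) ≡⟨ cong₂ _+_ (sum-cong-≗ (cong f ∘ next-inject₁)) (cong f (next-fromℕ n)) ⟩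
  ∑[ i < n ] f (fsuc i) + f fzero                      ≡⟨ +-comm _ (f fzero) ⟩
  ∑[ i < suc n ] f i                                   ∎
  where open ≡-Reasoning

next-backward-induction : ∀ {ℓ} (P : Pred (Fin (suc n)) ℓ) → (∀ c → P (next c) → P c) →
                          ∀ {c} → P c → ∀ d → P d
next-backward-induction {n} P step {c} Pc = >-weakInduction P P-last (λ i → step (inject₁ i) ∘ subst P (sym (next-inject₁ i)))
  where
  P-zero : P fzero
  P-zero = <-weakInduction (λ d → P d → P fzero) id (λ i h → h ∘ step (inject₁ i) ∘ subst P (sym (next-inject₁ i))) c Pc
  P-last : P (fromℕ n)
  P-last = step (fromℕ n) (subst P (sym (next-fromℕ n)) P-zero)

rotate : ℕ → Fin (suc n) → Fin (suc n)
rotate zero    = id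
rotate (suc k) = next ∘ rotate k

rotate-next : ∀ k (c : Fin (suc n)) → rotate k (next c) ≡ next (rotate k c)
rotate-next zero    c = refl
rotate-next (suc k) c = cong next (rotate-next k c)

rotate-injective : ∀ k {a b : Fin (suc n)} → rotate k a ≡ rotate k b → a ≡ b
rotate-injective zero    eq = eq
rotate-injective (suc k) eq = rotate-injective k (next-injective eq)

rotate-toℕ : ∀ (c : Fin (suc n)) → rotate (toℕ c) fzero ≡ c
rotate-toℕ = <-weakInduction (λ c → rotate (toℕ c) fzero ≡ c) refl step
  where
  step : ∀ i → rotate (toℕ (inject₁ i)) fzero ≡ inject₁ i → rotate (toℕ (fsuc i)) fzero ≡ fsuc i
  step i hyp = trans (cong (λ k → next (rotate k fzero)) (sym (toℕ-inject₁ i)))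
                     (trans (cong next hyp) (next-inject₁ i))

∑-rotate : ∀ k (f : Fin (suc n) → ℕ) → ∑[ i < suc n ] f (rotate k i) ≡ ∑[ i < suc n ] f i
∑-rotate zero    f = refl
∑-rotate (suc k) f = trans (sum-cong-≗ (λ i → cong f (sym (rotate-next k i)))) (trans (∑-next (f ∘ rotate k)) (∑-rotate k f))

finEq-rotate : ∀ k (a b : Fin (suc n)) → finEq (rotate k a) (rotate k b) ≡ finEq a b
finEq-rotate k = finEq-injective (rotate k) (rotate-injective k)

cycAdj-rotate : ∀ k (a b : Fin (suc n)) → cycAdj (rotate k a) (rotate k b) ≡ cycAdj a b
cycAdj-rotate k a b
  rewrite sym (rotate-next k a) | sym (rotate-next k b) | finEq-rotate k b (next a) | finEq-rotate k a (next b) = refl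

infix 7 _⊑_

_⊑_ : Maybe (Fin n) → Maybe (Fin n) → Bool
nothing ⊑ m       = true
just b  ⊑ nothing = false
just b  ⊑ just c  = finEq c b

compatible : Maybe (Fin n) → Maybe (Fin n) → Bool
compatible (just a) (just b) = finEq a b
compatible _        _        = true

pairwiseCompatible : List (Maybe (Fin n)) → Bool
pairwiseCompatible ts = all (λ t → all (compatible t) ts) ts

⊑-just : ∀ {c : Fin n} t → t ⊑ just c ≡ true → t ≡ nothing ⊎ t ≡ just c
⊑-just nothing  eq = inj₁ refl
⊑-just (just b) eq = inj₂ (cong just (sym (finEq⇒≡ eq)))

pairwiseCompatible-just : ∀ (ts : List (Maybe (Fin n))) {c} → just c ∈ ts →
                          pairwiseCompatible ts ≡ all (_⊑ just c) ts
pairwiseCompatible-just ts {c} c∈ts = bool-ext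
  (λ pc → all-intro _ ts λ t t∈ts → trans (sym (compatible≡⊑ t)) (all-elim (compatible (just c)) (all-elim _ pc c∈ts) t∈ts))
  (λ all⊑ → all-intro _ ts λ s s∈ts → all-intro _ ts λ t t∈ts →
     both-compatible (⊑-just s (all-elim _ all⊑ s∈ts)) (⊑-just t (all-elim _ all⊑ t∈ts)))
  where
  compatible≡⊑ : ∀ t → compatible (just c) t ≡ (t ⊑ just c)
  compatible≡⊑ nothing  = refl
  compatible≡⊑ (just b) = refl
  both-compatible : ∀ {s t} → s ≡ nothing ⊎ s ≡ just c → t ≡ nothing ⊎ t ≡ just c → compatible s t ≡ true
  both-compatible (inj₁ refl) _           = refl
  both-compatible (inj₂ refl) (inj₁ refl) = refl
  both-compatible (inj₂ refl) (inj₂ refl) = finEq-refl c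

nothings-or-just : ∀ (ts : List (Maybe (Fin n))) → (∀ {t} → t ∈ ts → t ≡ nothing) ⊎ ∃ λ c → just c ∈ ts
nothings-or-just []            = inj₁ (λ ())
nothings-or-just (just c ∷ ts) = inj₂ (c , here refl)
nothings-or-just (nothing ∷ ts) with nothings-or-just ts
... | inj₁ nothings    = inj₁ λ { (here refl) → refl ; (there t∈ts) → nothings t∈ts }
... | inj₂ (c , c∈ts) = inj₂ (c , there c∈ts)

compatible-sym : ∀ (s t : Maybe (Fin n)) → compatible s t ≡ compatible t s
compatible-sym (just a) (just b) = finEq-sym a b
compatible-sym (just _) nothing  = refl
compatible-sym nothing  (just _) = refl
compatible-sym nothing  nothing  = refl

pairwiseCompatible-intro : ∀ (ts : List (Maybe (Fin n))) →
                           (∀ {s t} → s ∈ ts → t ∈ ts → compatible s t ≡ true) → pairwiseCompatible ts ≡ true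
pairwiseCompatible-intro ts h = all-intro _ ts λ s s∈ts → all-intro _ ts λ t t∈ts → h s∈ts t∈ts

pairwiseCompatible-elim : ∀ {ts : List (Maybe (Fin n))} {s t} → pairwiseCompatible ts ≡ true →
                          s ∈ ts → t ∈ ts → compatible s t ≡ true
pairwiseCompatible-elim {ts = ts} {s} pc s∈ts t∈ts = all-elim (compatible s) (all-elim _ pc s∈ts) t∈ts

pairwiseCompatible-++ˡ : ∀ (xs ys : List (Maybe (Fin n))) →
                         pairwiseCompatible (xs ++ ys) ≡ true → pairwiseCompatible xs ≡ true
pairwiseCompatible-++ˡ xs ys pc =
  pairwiseCompatible-intro xs λ s∈xs t∈xs → pairwiseCompatible-elim pc (∈-++⁺ˡ s∈xs) (∈-++⁺ˡ t∈xs)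

pairwiseCompatible-inclusionExclusion :
  ∀ (ts : List (Maybe (Fin (suc n)))) W →
  (if pairwiseCompatible ts then W else 0) + n * (if all (_⊑ nothing) ts then W else 0)
    ≡ ∑[ c < suc n ] (if all (_⊑ just c) ts then W else 0)
pairwiseCompatible-inclusionExclusion {n} ts W with nothings-or-just ts
... | inj₁ nothings = begin
  (if pairwiseCompatible ts then W else 0) + n * (if all (_⊑ nothing) ts then W else 0)
    ≡⟨ cong₂ (λ a b → (if a then W else 0) + n * (if b then W else 0))
             (all-intro _ ts λ s _ → all-intro _ ts λ t t∈ts →
                subst (λ t → compatible s t ≡ true) (sym (nothings t∈ts)) (compatible-nothing s))
             (all-nothing nothing) ⟩
  suc n * W
    ≡⟨ sym (∑-const (suc n) W) ⟩
  ∑[ c < suc n ] W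
    ≡⟨ sum-cong-≗ (λ c → cong (λ b → if b then W else 0) (sym (all-nothing (just c)))) ⟩
  ∑[ c < suc n ] (if all (_⊑ just c) ts then W else 0) ∎
  where
  open ≡-Reasoning
  compatible-nothing : ∀ (s : Maybe (Fin (suc n))) → compatible s nothing ≡ true
  compatible-nothing nothing  = refl
  compatible-nothing (just _) = refl
  all-nothing : ∀ m → all (_⊑ m) ts ≡ true
  all-nothing m = all-intro _ ts λ t t∈ts → cong (_⊑ m) (nothings t∈ts)
... | inj₂ (c , c∈ts) = begin
  (if pairwiseCompatible ts then W else 0) + n * (if all (_⊑ nothing) ts then W else 0)
    ≡⟨ cong₂ (λ a b → (if a then W else 0) + n * (if b then W else 0))
             (pairwiseCompatible-just ts c∈ts) (all-false (_⊑ nothing) c∈ts refl) ⟩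
  (if all (_⊑ just c) ts then W else 0) + n * 0
    ≡⟨ trans (cong ((if all (_⊑ just c) ts then W else 0) +_) (*-zeroʳ n)) (+-identityʳ _) ⟩
  (if all (_⊑ just c) ts then W else 0)
    ≡⟨ sym (∑-single _ c (λ d d≢c → cong (λ b → if b then W else 0) (all-false (_⊑ just d) c∈ts (≢⇒finEq-false d≢c)))) ⟩
  ∑[ d < suc n ] (if all (_⊑ just d) ts then W else 0) ∎
  where open ≡-Reasoning

∑∈-allFuns-suc : ∀ s (xs : List A) (F : (Fin (suc s) → A) → ℕ) →
                 ∑[ v ∈ allFuns (suc s) xs ] F v ≡ ∑[ x ∈ xs ] ∑[ v ∈ allFuns s xs ] F (x Vec.∷ v)
∑∈-allFuns-suc s xs F = trans (∑∈-concatMap xs _ F) (∑∈-cong xs (λ x → ∑∈-map (allFuns s xs) (x Vec.∷_) F))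

SumsAgreeOn : (A → Bool) → List A → List A → Set
SumsAgreeOn P xs ys = ∀ (g : _ → ℕ) → (∀ x → P x ≡ false → g x ≡ 0) → ∑[ x ∈ xs ] g x ≡ ∑[ y ∈ ys ] g y

∑∈-allFuns-restrict : ∀ (P : A → Bool) {xs ys} → SumsAgreeOn P xs ys →
                      ∀ s (F : (Fin s → A) → ℕ) → (∀ v j → P (v j) ≡ false → F v ≡ 0) →
                      ∑[ v ∈ allFuns s xs ] F v ≡ ∑[ v ∈ allFuns s ys ] F v
∑∈-allFuns-restrict P           agree zero    F F≡0 = refl
∑∈-allFuns-restrict P {xs} {ys} agree (suc s) F F≡0 = begin
  ∑[ v ∈ allFuns (suc s) xs ] F v
    ≡⟨ ∑∈-allFuns-suc s xs F ⟩
  ∑[ x ∈ xs ] ∑[ v ∈ allFuns s xs ] F (x Vec.∷ v)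
    ≡⟨ ∑∈-cong xs (λ x → ∑∈-allFuns-restrict P agree s _ (λ v j → F≡0 (x Vec.∷ v) (fsuc j))) ⟩
  ∑[ x ∈ xs ] ∑[ v ∈ allFuns s ys ] F (x Vec.∷ v)
    ≡⟨ agree _ (λ x Px≡false → ∑∈-zero (allFuns s ys) (λ v → F≡0 (x Vec.∷ v) fzero Px≡false)) ⟩
  ∑[ y ∈ ys ] ∑[ v ∈ allFuns s ys ] F (y Vec.∷ v)
    ≡⟨ ∑∈-allFuns-suc s ys F ⟨
  ∑[ v ∈ allFuns (suc s) ys ] F v ∎
  where open ≡-Reasoning

∑∈-allFuns-map : ∀ (xs : List A) (e : A → B) s (F : (Fin s → B) → ℕ) → (∀ {v w} → v ≗ w → F v ≡ F w) →
                 ∑[ v ∈ allFuns s (map e xs) ] F v ≡ ∑[ u ∈ allFuns s xs ] F (e ∘ u)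
∑∈-allFuns-map xs e zero    F F-cong = cong (_+ 0) (F-cong (λ ()))
∑∈-allFuns-map xs e (suc s) F F-cong = begin
  ∑[ v ∈ allFuns (suc s) (map e xs) ] F v
    ≡⟨ ∑∈-allFuns-suc s (map e xs) F ⟩
  ∑[ y ∈ map e xs ] ∑[ v ∈ allFuns s (map e xs) ] F (y Vec.∷ v)
    ≡⟨ ∑∈-map xs e _ ⟩
  ∑[ x ∈ xs ] ∑[ v ∈ allFuns s (map e xs) ] F (e x Vec.∷ v)
    ≡⟨ ∑∈-cong xs (λ x → ∑∈-allFuns-map xs e s _ (λ v≗w → F-cong (λ { fzero → refl ; (fsuc j) → v≗w j }))) ⟩
  ∑[ x ∈ xs ] ∑[ u ∈ allFuns s xs ] F (e x Vec.∷ (e ∘ u))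
    ≡⟨ ∑∈-cong xs (λ x → ∑∈-cong (allFuns s xs) (λ u → F-cong (λ { fzero → refl ; (fsuc j) → refl }))) ⟩
  ∑[ x ∈ xs ] ∑[ u ∈ allFuns s xs ] F (e ∘ (x Vec.∷ u))
    ≡⟨ ∑∈-allFuns-suc s xs (F ∘ (e ∘_)) ⟨
  ∑[ u ∈ allFuns (suc s) xs ] F (e ∘ u) ∎
  where open ≡-Reasoning

labels : List Bool
labels = true ∷ false ∷ []

module _ (G : SunLike) where

  hubOf : Vertex G → Maybe (Fin (ℓ G))
  hubOf (inj₁ _)       = nothing
  hubOf (inj₂ (c , _)) = just c

  interaction : Vertex G → Vertex G → Bool → Maybe (Fin (ℓ G))
  interaction (inj₁ a) (inj₁ b)       look = if finEq a b ∧ look then just a else nothing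
  interaction (inj₁ a) (inj₂ (b , _)) _    = if finEq a b then just a else nothing
  interaction (inj₂ _) _              _    = nothing

  isWaitAtHub : Vertex G → Vertex G → Bool
  isWaitAtHub (inj₁ a) (inj₁ b) = finEq a b ∧ isHub G a
  isWaitAtHub _        _        = false

  isWaitAtCycle : Vertex G → Vertex G → Bool
  isWaitAtCycle (inj₁ a) (inj₁ b) = finEq a b
  isWaitAtCycle _        _        = false

  lookWeight : Vertex G → Bool → ℕ
  lookWeight (inj₁ c) true = leaves G c
  lookWeight _        _    = 1

  isStep : Vertex G → Vertex G → Bool
  isStep x y = eqV G x y ∨ adj G x y

  stepWeight : Vertex G → Vertex G → Bool → ℕ
  stepWeight x y look = (if isWaitAtCycle x y ∧ not look then 2 else 1) * lookWeight x look

  inScope : Maybe (Fin (ℓ G)) → Vertex G → Bool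
  inScope m x = hubOf x ⊑ m

  isDecoratedStep : Vertex G → Vertex G → Bool → Bool
  isDecoratedStep x y look = isStep x y ∧ (not look ∨ isWaitAtHub x y)

  -- scopedSum G m s is T(m): every step must start in scope m, be a step of a decorated route,
  -- and interact with no hub other than m.
  scopedStep : Maybe (Fin (ℓ G)) → Vertex G → Vertex G → Bool → ℕ
  scopedStep m x y look =
    if inScope m x ∧ (isDecoratedStep x y look ∧ interaction x y look ⊑ m) then stepWeight x y look else 0

  scopedWeight : Maybe (Fin (ℓ G)) → ∀ {s} → (Fin s → Vertex G) → (Fin s → Bool) → ℕ
  scopedWeight m {s} v lab = product (map (λ j → scopedStep m (v j) (v (next j)) (lab j)) (allFin s))

  scopedSum : Maybe (Fin (ℓ G)) → ℕ → ℕ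
  scopedSum m s = ∑[ v ∈ allFuns s (allVertices G) ] ∑[ lab ∈ allFuns s labels ] scopedWeight m v lab

  scopedWeight-outside : ∀ m {s} (v : Fin s → Vertex G) lab j → inScope m (v j) ≡ false → scopedWeight m v lab ≡ 0
  scopedWeight-outside m {s} v lab j outside =
    product-zero (allFin s) (∈-allFin j)
      (cong (λ b → if b ∧ (isDecoratedStep x y l ∧ interaction x y l ⊑ m) then stepWeight x y l else 0) outside)
    where x = v j ; y = v (next j) ; l = lab j

  scopedWeight-cong : ∀ m {s} {v w : Fin s → Vertex G} lab → v ≗ w → scopedWeight m v lab ≡ scopedWeight m w lab
  scopedWeight-cong m {s} lab v≗w =
    cong product (map-cong (λ j → cong₂ (λ x y → scopedStep m x y (lab j)) (v≗w j) (v≗w (next j))) (allFin s))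

scopedSum-encode : ∀ (G : SunLike) m {as : List A} (e : A → Vertex G) →
                   SumsAgreeOn (inScope G m) (allVertices G) (map e as) → ∀ s →
                   scopedSum G m s ≡ ∑[ u ∈ allFuns s as ] ∑[ lab ∈ allFuns s labels ] scopedWeight G m (e ∘ u) lab
scopedSum-encode G m {as} e agree s =
  trans (∑∈-allFuns-restrict (inScope G m) agree s _
          (λ v j outside → ∑∈-zero (allFuns s labels) (λ lab → scopedWeight-outside G m v lab j outside)))
        (∑∈-allFuns-map as e s _ (λ v≗w → ∑∈-cong (allFuns s labels) (λ lab → scopedWeight-cong G m lab v≗w)))

scopedSum-transport :
  ∀ (G H : SunLike) mG mH {as : List A} (eG : A → Vertex G) (eH : A → Vertex H) →
  SumsAgreeOn (inScope G mG) (allVertices G) (map eG as) →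
  SumsAgreeOn (inScope H mH) (allVertices H) (map eH as) →
  (∀ a b look → scopedStep G mG (eG a) (eG b) look ≡ scopedStep H mH (eH a) (eH b) look) →
  ∀ s → scopedSum G mG s ≡ scopedSum H mH s
scopedSum-transport G H mG mH {as} eG eH agreeG agreeH same-steps s =
  trans (scopedSum-encode G mG eG agreeG s)
    (trans (∑∈-cong (allFuns s as) λ u → ∑∈-cong (allFuns s labels) λ lab →
              cong product (map-cong (λ j → same-steps (u j) (u (next j)) (lab j)) (allFin s)))
      (sym (scopedSum-encode H mH eH agreeH s)))

sun : ∀ n → 3 ≤ suc n → (Fin (suc n) → ℕ) → SunLike
sun n 3≤ℓ L = record { ℓ = suc n ; 3≤ℓ = 3≤ℓ ; leaves = L }

∑∈-allVertices : ∀ (G : SunLike) (g : Vertex G → ℕ) →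
                 ∑[ x ∈ allVertices G ] g x
                   ≡ ∑[ c < ℓ G ] g (inj₁ c) + ∑[ c < ℓ G ] ∑[ i < leaves G c ] g (inj₂ (c , i))
∑∈-allVertices G g = begin
  ∑[ x ∈ allVertices G ] g x
    ≡⟨ ∑∈-++ (map inj₁ (allFin (ℓ G))) _ g ⟩
  ∑[ x ∈ map inj₁ (allFin (ℓ G)) ] g x + ∑[ x ∈ concatMap leavesOf (allFin (ℓ G)) ] g x
    ≡⟨ cong₂ _+_ (∑∈-map (allFin (ℓ G)) inj₁ g) (∑∈-concatMap (allFin (ℓ G)) leavesOf g) ⟩
  ∑[ c ∈ allFin (ℓ G) ] g (inj₁ c) + ∑[ c ∈ allFin (ℓ G) ] ∑[ x ∈ leavesOf c ] g x
    ≡⟨ cong₂ _+_ (∑∈-allFin (ℓ G) _) (trans (∑∈-allFin (ℓ G) _) (sum-cong-≗ λ c →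
         trans (∑∈-map (allFin (leaves G c)) (λ i → inj₂ (c , i)) g) (∑∈-allFin (leaves G c) _))) ⟩
  ∑[ c < ℓ G ] g (inj₁ c) + ∑[ c < ℓ G ] ∑[ i < leaves G c ] g (inj₂ (c , i)) ∎
  where
  open ≡-Reasoning
  leavesOf : Fin (ℓ G) → List (Vertex G)
  leavesOf c = map (λ i → inj₂ (c , i)) (allFin (leaves G c))

cycleSumsAgree : ∀ (G : SunLike) → SumsAgreeOn (inScope G nothing) (allVertices G) (map inj₁ (allFin (ℓ G)))
cycleSumsAgree G g outside≡0 = begin
  ∑[ x ∈ allVertices G ] g x
    ≡⟨ ∑∈-allVertices G g ⟩
  ∑[ c < ℓ G ] g (inj₁ c) + ∑[ c < ℓ G ] ∑[ i < leaves G c ] g (inj₂ (c , i))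
    ≡⟨ cong (∑[ c < ℓ G ] g (inj₁ c) +_) (trans (sum-cong-≗ λ c → trans (sum-cong-≗ λ i → outside≡0 (inj₂ (c , i)) refl)
                                                                          (sum-replicate-zero (leaves G c)))
                                                      (sum-replicate-zero (ℓ G))) ⟩
  ∑[ c < ℓ G ] g (inj₁ c) + 0
    ≡⟨ +-identityʳ _ ⟩
  ∑[ c < ℓ G ] g (inj₁ c)
    ≡⟨ trans (∑∈-map (allFin (ℓ G)) inj₁ g) (∑∈-allFin (ℓ G) _) ⟨
  ∑[ x ∈ map inj₁ (allFin (ℓ G)) ] g x ∎
  where open ≡-Reasoning

scopedSum-nothing : ∀ n p p' (L L' : Fin (suc n) → ℕ) s →
                    scopedSum (sun n p L) nothing s ≡ scopedSum (sun n p' L') nothing s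
scopedSum-nothing n p p' L L' = scopedSum-transport (sun n p L) (sun n p' L') nothing nothing {allFin (suc n)} inj₁ inj₁
  (cycleSumsAgree (sun n p L)) (cycleSumsAgree (sun n p' L')) same-steps
  where
  same-steps : ∀ a b look → scopedStep (sun n p L) nothing (inj₁ a) (inj₁ b) look
                             ≡ scopedStep (sun n p' L') nothing (inj₁ a) (inj₁ b) look
  same-steps a b false = refl
  same-steps a b true with finEq a b
  ... | true  rewrite ∧-zeroʳ (isHub (sun n p L) a) | ∧-zeroʳ (isHub (sun n p' L') a) = refl
  ... | false rewrite ∧-zeroʳ (cycAdj a b) = refl

singleHub : ℕ → Fin (suc n) → ℕ
singleHub m fzero    = m
singleHub m (fsuc _) = 0

module _ (n : ℕ) (p : 3 ≤ suc n) (L : Fin (suc n) → ℕ) (k : ℕ) where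

  private
    G = sun n p L
    ρ = rotate {n} k
    c = ρ fzero

  rotatedEmbedding : Fin (suc n) ⊎ Fin (L c) → Vertex G
  rotatedEmbedding (inj₁ x) = inj₁ (ρ x)
  rotatedEmbedding (inj₂ i) = inj₂ (c , i)

  cycleAndHub : List (Fin (suc n) ⊎ Fin (L c))
  cycleAndHub = map inj₁ (allFin (suc n)) ++ map inj₂ (allFin (L c))

  hubSumsAgree : SumsAgreeOn (inScope G (just c)) (allVertices G) (map rotatedEmbedding cycleAndHub)
  hubSumsAgree g outside≡0 = begin
    ∑[ x ∈ allVertices G ] g x
      ≡⟨ ∑∈-allVertices G g ⟩
    ∑[ x < suc n ] g (inj₁ x) + ∑[ d < suc n ] ∑[ i < L d ] g (inj₂ (d , i))
      ≡⟨ cong₂ _+_ (sym (∑-rotate k (g ∘ inj₁))) (∑-single _ c λ d d≢c →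
           trans (sum-cong-≗ λ i → outside≡0 (inj₂ (d , i)) (≢⇒finEq-false (d≢c ∘ sym))) (sum-replicate-zero (L d))) ⟩
    ∑[ x < suc n ] g (inj₁ (ρ x)) + ∑[ i < L c ] g (inj₂ (c , i))
      ≡⟨ cong₂ _+_ (∑∈-allFin (suc n) _) (∑∈-allFin (L c) _) ⟨
    ∑[ x ∈ allFin (suc n) ] g (inj₁ (ρ x)) + ∑[ i ∈ allFin (L c) ] g (inj₂ (c , i))
      ≡⟨ cong₂ _+_ (∑∈-map (allFin (suc n)) inj₁ (g ∘ rotatedEmbedding)) (∑∈-map (allFin (L c)) inj₂ (g ∘ rotatedEmbedding)) ⟨
    ∑[ a ∈ map inj₁ (allFin (suc n)) ] g (rotatedEmbedding a) + ∑[ a ∈ map inj₂ (allFin (L c)) ] g (rotatedEmbedding a)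
      ≡⟨ ∑∈-++ (map inj₁ (allFin (suc n))) _ (g ∘ rotatedEmbedding) ⟨
    ∑[ a ∈ cycleAndHub ] g (rotatedEmbedding a)
      ≡⟨ ∑∈-map cycleAndHub rotatedEmbedding g ⟨
    ∑[ x ∈ map rotatedEmbedding cycleAndHub ] g x ∎
    where open ≡-Reasoning

module _ (n : ℕ) (p : 3 ≤ suc n) (L : Fin (suc n) → ℕ) (k : ℕ) where

  private
    G = sun n p L
    ρ = rotate {n} k
    c = ρ fzero
    H = sun n p (singleHub (L c))

  rotatedSteps : ∀ a b look →
                 scopedStep G (just c) (rotatedEmbedding n p L k a) (rotatedEmbedding n p L k b) look
                   ≡ scopedStep H (just fzero) (rotatedEmbedding n p (singleHub (L c)) 0 a) (rotatedEmbedding n p (singleHub (L c)) 0 b) look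
  rotatedSteps (inj₁ x) (inj₁ y) false rewrite finEq-rotate k x y | cycAdj-rotate k x y | ∧-zeroʳ (finEq x y) = refl
  rotatedSteps (inj₁ x) (inj₁ y) true rewrite finEq-rotate k x y | cycAdj-rotate k x y with finEq x y in x≟y
  ... | false rewrite ∧-zeroʳ (cycAdj x y) = refl
  ... | true with finEq⇒≡ x≟y
  ... | refl rewrite finEq-rotate k fzero x with x
  ... | fzero   = refl
  ... | fsuc x₀ rewrite ∧-zeroʳ (isHub G (ρ (fsuc x₀))) = refl
  rotatedSteps (inj₁ x) (inj₂ i) look rewrite finEq-rotate k x fzero with x | look
  ... | fzero  | false rewrite finEq-refl c = refl
  ... | fzero  | true  = refl
  ... | fsuc _ | _     = refl
  rotatedSteps (inj₂ i) (inj₁ y) look rewrite finEq-rotate k fzero y | finEq-refl c = refl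
  rotatedSteps (inj₂ i) (inj₂ j) look rewrite finEq-refl c = refl

  scopedSum-rotate : ∀ s → scopedSum G (just c) s ≡ scopedSum H (just fzero) s
  scopedSum-rotate = scopedSum-transport G H (just c) (just fzero) {cycleAndHub n p L k}
    (rotatedEmbedding n p L k) (rotatedEmbedding n p (singleHub (L c)) 0)
    (hubSumsAgree n p L k) (hubSumsAgree n p (singleHub (L c)) 0) rotatedSteps

scopedSum-just : ∀ n p (L : Fin (suc n) → ℕ) c s →
                 scopedSum (sun n p L) (just c) s ≡ scopedSum (sun n p (singleHub (L c))) (just fzero) s
scopedSum-just n p L c s =
  subst (λ d → scopedSum (sun n p L) (just d) s ≡ scopedSum (sun n p (singleHub (L d))) (just fzero) s)
        (rotate-toℕ c) (scopedSum-rotate n p L (toℕ c) s)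

module Route (G : SunLike) {s : ℕ} (v : Fin s → Vertex G) (lab : Fin s → Bool) where

  interactions : List (Maybe (Fin (ℓ G)))
  interactions = map (λ j → interaction G (v j) (v (next j)) (lab j)) (allFin s)

  visitedHubs : List (Maybe (Fin (ℓ G)))
  visitedHubs = map (λ j → hubOf G (v j)) (allFin s)

  decorated : Bool
  decorated = all (λ j → isDecoratedStep G (v j) (v (next j)) (lab j)) (allFin s)

  routeWeight : ℕ
  routeWeight = product (map (λ j → stepWeight G (v j) (v (next j)) (lab j)) (allFin s))

  private
    waitCyc≡ : ∀ j → waitCyc G v j ≡ isWaitAtCycle G (v j) (v (next j))
    waitCyc≡ j with v j | v (next j)
    ... | inj₁ _ | inj₁ _ = refl
    ... | inj₁ _ | inj₂ _ = refl
    ... | inj₂ _ | _      = refl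

    waitHub≡ : ∀ j → waitHub G v j ≡ isWaitAtHub G (v j) (v (next j))
    waitHub≡ j with v j | v (next j)
    ... | inj₁ _ | inj₁ _ = refl
    ... | inj₁ _ | inj₂ _ = refl
    ... | inj₂ _ | _      = refl

    interactsAt≡ : ∀ j → interactsAt G (v , lab) j ≡ interaction G (v j) (v (next j)) (lab j)
    interactsAt≡ j with v j | v (next j)
    ... | inj₁ _ | inj₁ _ = refl
    ... | inj₁ _ | inj₂ _ = refl
    ... | inj₂ _ | _      = refl

    lookFactor≡ : ∀ j → lookFactor G (v , lab) j ≡ lookWeight G (v j) (lab j)
    lookFactor≡ j with lab j | v j
    ... | true  | inj₁ _ = refl
    ... | true  | inj₂ _ = refl
    ... | false | inj₁ _ = refl
    ... | false | inj₂ _ = refl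

    sameOrNone≡ : ∀ t t′ → sameOrNone G {s} t t′ ≡ compatible t t′
    sameOrNone≡ (just _) (just _) = refl
    sameOrNone≡ (just _) nothing  = refl
    sameOrNone≡ nothing  _        = refl

  weight≡ : weight G (v , lab) ≡ routeWeight
  weight≡ = sym (begin
    routeWeight
      ≡⟨ product-* doubling looking (allFin s) ⟩
    product (map doubling (allFin s)) * product (map looking (allFin s))
      ≡⟨ cong₂ _*_ (cong product (map-cong (λ j → cong (λ b → if b ∧ not (lab j) then 2 else 1) (sym (waitCyc≡ j))) (allFin s)))
                   (cong product (map-cong (sym ∘ lookFactor≡) (allFin s))) ⟩
    product (map (λ j → if waitCyc G v j ∧ not (lab j) then 2 else 1) (allFin s)) * product (map (lookFactor G (v , lab)) (allFin s))
      ≡⟨ cong (_* product (map (lookFactor G (v , lab)) (allFin s))) (product-2^ (λ j → waitCyc G v j ∧ not (lab j)) (allFin s)) ⟩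
    weight G (v , lab) ∎)
    where
    open ≡-Reasoning
    doubling looking : Fin s → ℕ
    doubling j = if isWaitAtCycle G (v j) (v (next j)) ∧ not (lab j) then 2 else 1
    looking  j = lookWeight G (v j) (lab j)

  scopedWeight≡ : ∀ m → scopedWeight G m v lab ≡ (if decorated ∧ all (_⊑ m) (interactions ++ visitedHubs) then routeWeight else 0)
  scopedWeight≡ m = trans (product-if allowed (λ j → stepWeight G (v j) (v (next j)) (lab j)) (allFin s))
                          (cong (λ b → if b then routeWeight else 0) allowed≡)
    where
    open ≡-Reasoning
    inScopeᵢ decoratedᵢ interactionᵢ⊑ allowed : Fin s → Bool
    inScopeᵢ       j = inScope G m (v j)
    decoratedᵢ     j = isDecoratedStep G (v j) (v (next j)) (lab j)
    interactionᵢ⊑ j = interaction G (v j) (v (next j)) (lab j) ⊑ m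
    allowed        j = inScopeᵢ j ∧ (decoratedᵢ j ∧ interactionᵢ⊑ j)
    allowed≡ : all allowed (allFin s) ≡ decorated ∧ all (_⊑ m) (interactions ++ visitedHubs)
    allowed≡ = begin
      all allowed (allFin s)
        ≡⟨ trans (all-∧ inScopeᵢ _ (allFin s)) (cong (all inScopeᵢ (allFin s) ∧_) (all-∧ decoratedᵢ interactionᵢ⊑ (allFin s))) ⟩
      all inScopeᵢ (allFin s) ∧ (decorated ∧ all interactionᵢ⊑ (allFin s))
        ≡⟨ trans (∧-comm (all inScopeᵢ (allFin s)) _) (∧-assoc decorated _ _) ⟩
      decorated ∧ (all interactionᵢ⊑ (allFin s) ∧ all inScopeᵢ (allFin s))
        ≡⟨ cong (decorated ∧_) (cong₂ _∧_ (all-map (_⊑ m) _ (allFin s)) (all-map (_⊑ m) _ (allFin s))) ⟨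
      decorated ∧ (all (_⊑ m) interactions ∧ all (_⊑ m) visitedHubs)
        ≡⟨ cong (decorated ∧_) (all-++ (_⊑ m) interactions visitedHubs) ⟨
      decorated ∧ all (_⊑ m) (interactions ++ visitedHubs) ∎

  inDstar≡ : inDstar G (v , lab) ≡ decorated ∧ pairwiseCompatible interactions
  inDstar≡ = begin
    isRoute G v ∧ (isDecoration G v lab ∧ atMostOneHub G (v , lab))
      ≡⟨ ∧-assoc (isRoute G v) _ _ ⟨
    (isRoute G v ∧ isDecoration G v lab) ∧ atMostOneHub G (v , lab)
      ≡⟨ cong₂ _∧_ route∧decoration≡ atMostOneHub≡ ⟩
    decorated ∧ pairwiseCompatible interactions ∎
    where
    open ≡-Reasoning
    route∧decoration≡ : isRoute G v ∧ isDecoration G v lab ≡ decorated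
    route∧decoration≡ = sym (trans (all-∧ _ _ (allFin s))
      (cong (isRoute G v ∧_) (all-cong (allFin s) λ j → cong (not (lab j) ∨_) (sym (waitHub≡ j)))))
    atMostOneHub≡ : atMostOneHub G (v , lab) ≡ pairwiseCompatible interactions
    atMostOneHub≡ = sym (trans (all-map _ _ (allFin s)) (all-cong (allFin s) λ j →
      trans (all-map _ _ (allFin s)) (all-cong (allFin s) λ j′ →
        trans (cong₂ compatible (sym (interactsAt≡ j)) (sym (interactsAt≡ j′)))
              (sym (sameOrNone≡ (interactsAt G (v , lab) j) (interactsAt G (v , lab) j′))))))

module LeafEntry (G : SunLike) {s : ℕ} (v : Fin (suc s) → Vertex G) (lab : Fin (suc s) → Bool)
                 (steps : ∀ j → isStep G (v j) (v (next j)) ≡ true) where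

  open Route G v lab

  private
    int : Fin (suc s) → Maybe (Fin (ℓ G))
    int j = interaction G (v j) (v (next j)) (lab j)

    hub : Fin (suc s) → Maybe (Fin (ℓ G))
    hub j = hubOf G (v j)

  step-onto-leaf : ∀ x {d i} look → isStep G x (inj₂ (d , i)) ≡ true →
                   interaction G x (inj₂ (d , i)) look ≢ just d → x ≡ inj₂ (d , i)
  step-onto-leaf (inj₁ a) look step ¬enters rewrite step = contradiction (cong just (finEq⇒≡ step)) ¬enters
  step-onto-leaf (inj₂ (d′ , i′)) {d} {i} look step ¬enters with finEq d′ d in d′≟d | finEq i′ i in i′≟i
  step-onto-leaf (inj₂ (d′ , i′)) {d} {i} look step ¬enters | true | true with finEq⇒≡ d′≟d
  ... | refl = cong (λ i → inj₂ (d , i)) (finEq⇒≡ i′≟i)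
  step-onto-leaf (inj₂ (d′ , i′)) look () ¬enters | true | false
  step-onto-leaf (inj₂ (d′ , i′)) look () ¬enters | false | _

  hub-entered-or-constant : ∀ k {d i} → v k ≡ inj₂ (d , i) → (∃ λ j → int j ≡ just d) ⊎ (∀ j → v j ≡ inj₂ (d , i))
  hub-entered-or-constant k {d} {i} vk≡leaf with any? (λ j → Maybe.≡-dec Fin._≟_ (int j) (just d))
  ... | yes entered   = inj₁ entered
  ... | no ¬entered = inj₂ (next-backward-induction (λ j → v j ≡ inj₂ (d , i)) stays-before vk≡leaf)
    where
    stays-before : ∀ j → v (next j) ≡ inj₂ (d , i) → v j ≡ inj₂ (d , i)
    stays-before j next≡leaf = step-onto-leaf (v j) (lab j) (subst (λ y → isStep G (v j) y ≡ true) next≡leaf (steps j))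
      (λ enters → ¬entered (j , subst (λ y → interaction G (v j) y (lab j) ≡ just d) (sym next≡leaf) enters))

  module _ (int-compatible : ∀ j j′ → compatible (int j) (int j′) ≡ true) where

    hub-compatible-int : ∀ k j → compatible (hubOf G (v k)) (int j) ≡ true
    hub-compatible-int k j with v k in vk≡
    ... | inj₁ _ = refl
    ... | inj₂ (d , i) with hub-entered-or-constant k vk≡
    ...   | inj₁ (j′ , int≡d) = subst (λ t → compatible t (int j) ≡ true) int≡d (int-compatible j′ j)
    ...   | inj₂ constant rewrite constant j = refl

    hub-compatible-hub : ∀ j k → compatible (hubOf G (v j)) (hubOf G (v k)) ≡ true
    hub-compatible-hub j k with v j in vj≡ | v k in vk≡
    ... | inj₁ _       | _             = refl
    ... | inj₂ _       | inj₁ _        = refl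
    ... | inj₂ (d , i) | inj₂ (d′ , _) with hub-entered-or-constant j vj≡
    ...   | inj₂ constant = subst (λ x → compatible (just d) (hubOf G x) ≡ true) (trans (sym (constant k)) vk≡) (finEq-refl d)
    ...   | inj₁ (m , int≡d) = subst (λ t → compatible t (just d′) ≡ true) int≡d
             (trans (compatible-sym (int m) (just d′)) (subst (λ x → compatible (hubOf G x) (int m) ≡ true) vk≡ (hub-compatible-int k m)))

  pairwiseCompatible-visitedHubs : pairwiseCompatible interactions ≡ pairwiseCompatible (interactions ++ visitedHubs)
  pairwiseCompatible-visitedHubs = bool-ext to (pairwiseCompatible-++ˡ interactions visitedHubs)
    where
    to : pairwiseCompatible interactions ≡ true → pairwiseCompatible (interactions ++ visitedHubs) ≡ true
    to pc = pairwiseCompatible-intro _ λ s∈ t∈ → both (∈-++⁻ interactions s∈) (∈-++⁻ interactions t∈)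
      where
      int-compatible : ∀ j j′ → compatible (int j) (int j′) ≡ true
      int-compatible j j′ = pairwiseCompatible-elim pc (∈-map⁺ int (∈-allFin j)) (∈-map⁺ int (∈-allFin j′))
      both : ∀ {s t} → s ∈ interactions ⊎ s ∈ visitedHubs → t ∈ interactions ⊎ t ∈ visitedHubs → compatible s t ≡ true
      both (inj₁ s∈ints) (inj₁ t∈ints) = pairwiseCompatible-elim pc s∈ints t∈ints
      both (inj₁ s∈ints) (inj₂ t∈hubs) with ∈-map⁻ int s∈ints | ∈-map⁻ hub t∈hubs
      ... | j , _ , refl | k , _ , refl = trans (compatible-sym (int j) _) (hub-compatible-int int-compatible k j)
      both (inj₂ s∈hubs) (inj₁ t∈ints) with ∈-map⁻ hub s∈hubs | ∈-map⁻ int t∈ints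
      ... | k , _ , refl | j , _ , refl = hub-compatible-int int-compatible k j
      both (inj₂ s∈hubs) (inj₂ t∈hubs) with ∈-map⁻ hub s∈hubs | ∈-map⁻ hub t∈hubs
      ... | j , _ , refl | k , _ , refl = hub-compatible-hub int-compatible j k

pairwiseCompatible-visitedHubs : ∀ (G : SunLike) {s} (v : Fin s → Vertex G) lab → Route.decorated G v lab ≡ true →
  pairwiseCompatible (Route.interactions G v lab) ≡ pairwiseCompatible (Route.interactions G v lab ++ Route.visitedHubs G v lab)
pairwiseCompatible-visitedHubs G {zero}  v lab _   = refl
pairwiseCompatible-visitedHubs G {suc s} v lab dec = LeafEntry.pairwiseCompatible-visitedHubs G v lab
  (λ j → ∧-conicalˡ _ _ (all-elim _ dec (∈-allFin j)))

module _ (n : ℕ) (p : 3 ≤ suc n) (L : Fin (suc n) → ℕ) where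

  private
    G = sun n p L

  dstarWeight-inclusionExclusion :
    ∀ {s} (v : Fin s → Vertex G) lab →
    (if inDstar G (v , lab) then weight G (v , lab) else 0) + n * scopedWeight G nothing v lab
      ≡ ∑[ c < suc n ] scopedWeight G (just c) v lab
  dstarWeight-inclusionExclusion {s} v lab
    rewrite Route.inDstar≡ G v lab | Route.weight≡ G v lab | Route.scopedWeight≡ G v lab nothing
          | sum-cong-≗ (λ c → Route.scopedWeight≡ G v lab (just c))
    with Route.decorated G v lab in dec
  ... | false = trans (cong (0 +_) (*-zeroʳ n)) (sym (sum-replicate-zero (suc n)))
  ... | true  = trans (cong (λ b → (if b then routeWeight else 0) + n * (if all (_⊑ nothing) ts then routeWeight else 0))
                            (pairwiseCompatible-visitedHubs G v lab dec))
                      (pairwiseCompatible-inclusionExclusion ts routeWeight)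
    where
    open Route G v lab
    ts = interactions ++ visitedHubs

  dstarSum-inclusionExclusion : ∀ s → DstarSum G s + n * scopedSum G nothing s ≡ ∑[ c < suc n ] scopedSum G (just c) s
  dstarSum-inclusionExclusion s = begin
    DstarSum G s + n * scopedSum G nothing s
      ≡⟨ cong₂ _+_ (trans (∑∈-filter (allDRoutes G s) (inDstar G) (weight G)) (∑∈-cartesianProduct Vs Ls D))
                   (trans (*-distribˡ-∑∈ n Vs _) (∑∈-cong Vs λ v → *-distribˡ-∑∈ n Ls _)) ⟩
    ∑[ v ∈ Vs ] ∑[ lab ∈ Ls ] D (v , lab) + ∑[ v ∈ Vs ] ∑[ lab ∈ Ls ] (n * scopedWeight G nothing v lab)
      ≡⟨ trans (∑∈-cong Vs λ v → ∑∈-distrib-+ Ls _ _) (∑∈-distrib-+ Vs _ _) ⟨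
    ∑[ v ∈ Vs ] ∑[ lab ∈ Ls ] (D (v , lab) + n * scopedWeight G nothing v lab)
      ≡⟨ ∑∈-cong Vs (λ v → ∑∈-cong Ls (dstarWeight-inclusionExclusion v)) ⟩
    ∑[ v ∈ Vs ] ∑[ lab ∈ Ls ] ∑[ c < suc n ] scopedWeight G (just c) v lab
      ≡⟨ trans (∑∈-cong Vs λ v → ∑∈-∑-comm Ls (suc n) (λ lab c → scopedWeight G (just c) v lab))
               (∑∈-∑-comm Vs (suc n) (λ v c → ∑[ lab ∈ Ls ] scopedWeight G (just c) v lab)) ⟩
    ∑[ c < suc n ] scopedSum G (just c) s ∎
    where
    open ≡-Reasoning
    Vs = allFuns s (allVertices G)
    Ls = allFuns s labels
    D : DRoute G s → ℕ
    D R = if inDstar G R then weight G R else 0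

lemma4p5 : (G G' : SunLike) → ℓ G ≡ ℓ G' →
    (∀ (i : ℕ) → 1 ≤ i → hubCount G i ≡ hubCount G' i) →
    (s : ℕ) → 1 ≤ s → DstarSum G s ≡ DstarSum G' s
lemma4p5 record { ℓ = zero ; 3≤ℓ = () } _ _ _ _ _
-- The argument works for every s.
lemma4p5 record { ℓ = suc n ; 3≤ℓ = p ; leaves = L } record { ℓ = .(suc n) ; 3≤ℓ = p′ ; leaves = L′ } refl sameHubs s _
  with ≤-irrelevant p p′
... | refl = +-cancelʳ-≡ (n * scopedSum G′ nothing s) _ _ (begin
  DstarSum G s + n * scopedSum G′ nothing s  ≡⟨ cong (λ t → DstarSum G s + n * t) (scopedSum-nothing n p p L′ L s) ⟩
  DstarSum G s + n * scopedSum G nothing s   ≡⟨ dstarSum-inclusionExclusion n p L s ⟩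
  ∑[ c < suc n ] scopedSum G (just c) s      ≡⟨ sum-cong-≗ {suc n} (λ c → scopedSum-just n p L c s) ⟩
  ∑[ c < suc n ] singleHubSum (L c)          ≡⟨ ∑-sameValueCounts L L′ sameHubs singleHubSum ⟩
  ∑[ c < suc n ] singleHubSum (L′ c)         ≡⟨ sum-cong-≗ {suc n} (λ c → scopedSum-just n p L′ c s) ⟨
  ∑[ c < suc n ] scopedSum G′ (just c) s     ≡⟨ dstarSum-inclusionExclusion n p L′ s ⟨
  DstarSum G′ s + n * scopedSum G′ nothing s ∎)
  where
  open ≡-Reasoning
  G = sun n p L
  G′ = sun n p L′
  singleHubSum : ℕ → ℕ
  singleHubSum m = scopedSum (sun n p (singleHub m)) (just fzero) s
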